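{- For every positive rational number $r$ there exists $u\in\mathbb{N}$ such that \[ \frac{s_2(u^2)}{s_2(u)}=r. \]
   Context: For an integer $q\geq 2$ and $n\in\mathbb{N}$, $s_q(n)$ denotes the sum of the digits of $n$ written in base $q$; so $s_2(n)$ is the number of $1$s in the binary expansion of $n$. -}

module Defs where

open import Data.Nat using (ℕ; zero; suc; _+_; _%_; _/_)

-- s₂ n : the sum of the binary digits of n (number of 1s in base 2).
-- Defined with fuel: s₂-aux k n computes the digit sum correctly whenever n < 2^k;
-- fuel n suffices since n < 2^n.
s₂-aux : ℕ → ℕ → ℕ
s₂-aux zero    n = 0
s₂-aux (suc k) n = n % 2 + s₂-aux k (n / 2)

s₂ : ℕ → ℕ
s₂ n = s₂-aux n n

module Submission where

-- The construction is carried out in ℕ (module Construction) and has four parts.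
-- 1. Digit-sum calculus: s₂(2h) = s₂ h, s₂(2h+1) = 1 + s₂ h, concatenation
--    s₂(a + 2^n·b) = s₂ a + s₂ b for a < 2^n, and complements: a + b = 2^n − 1 ⇒ s₂ a + s₂ b = n.
-- 2. Repetition: m widely spaced copies of u have digit sum m·s₂ u, their square T m·s₂(u²)
--    with T m = m(m+1)/2; for m = 2k − 1 this multiplies the ratio s₂(u²)/s₂(u) by k.
-- 3. A family u = 2^(D+f+1) − w, with w sparse, whose square splits into carry-free blocks;
--    its parameters can be chosen so that s₂ u = Q·s₂(u²), i.e. it realises the ratio 1/Q,
--    whenever 2^(1+(h+1)(ρ+1)) = Q + ρ + 1.
-- 4. Arithmetic: for t₀ = (d+1)! write 2^(t₀+1) − 1 = ρ + (j+1)(d+1) with ρ ≤ d; then ρ + 1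
--    divides t₀, so 1/Q with Q = (j+1)(d+1) is realised, and scaling by k = (n+1)(j+1) and
--    cancelling j + 1 realises (n+1)/(d+1).

open import Defs

module Construction where

  open import Data.Nat
  open import Data.Nat.Properties
  open import Data.Nat.DivMod
  open import Data.Nat.Divisibility using (_∣_; divides; n∣m*n; m∣m*n; ∣-trans; ∣⇒≤; m≤n⇒m!∣n!)
  open import Data.Product using (Σ; _,_; _×_)
  open import Data.Sum using (_⊎_; inj₁; inj₂)
  open import Data.Empty using (⊥-elim)
  open import Relation.Binary.PropositionalEquality
  open import Data.Nat.Tactic.RingSolver using (solve-∀)

  halve : ∀ n → (Σ ℕ λ h → n ≡ h * 2) ⊎ (Σ ℕ λ h → n ≡ 1 + h * 2)
  halve zero = inj₁ (0 , refl)
  halve (suc n) with halve n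
  ... | inj₁ (h , n≡2h) = inj₂ (h , cong suc n≡2h)
  ... | inj₂ (h , n≡2h+1) = inj₁ (suc h , cong suc n≡2h+1)

  2^-+ : ∀ m n → 2 ^ (m + n) ≡ 2 ^ m * 2 ^ n
  2^-+ = ^-distribˡ-+-* 2

  n<2^n : ∀ n → n < 2 ^ n
  n<2^n zero = s≤s z≤n
  n<2^n (suc n) = +-mono-≤ (m^n>0 2 n) (subst (n <_) (sym (+-identityʳ (2 ^ n))) (n<2^n n))

  <2^-mono : ∀ {x n n'} → x < 2 ^ n → n ≤ n' → x < 2 ^ n'
  <2^-mono x< n≤n' = <-≤-trans x< (^-monoʳ-≤ 2 n≤n')

  concat-bound : ∀ n m a b → a < 2 ^ n → b < 2 ^ m → a + 2 ^ n * b < 2 ^ (n + m)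
  concat-bound n m a b a< b< = begin-strict
      a + 2 ^ n * b         <⟨ +-monoˡ-< (2 ^ n * b) a< ⟩
      2 ^ n + 2 ^ n * b     ≡⟨ cong (_+ 2 ^ n * b) (*-identityʳ (2 ^ n)) ⟨
      2 ^ n * 1 + 2 ^ n * b ≡⟨ *-distribˡ-+ (2 ^ n) 1 b ⟨
      2 ^ n * suc b         ≤⟨ *-monoʳ-≤ (2 ^ n) b< ⟩
      2 ^ n * 2 ^ m         ≡⟨ 2^-+ n m ⟨
      2 ^ (n + m)           ∎
    where open ≤-Reasoning

  product-bound : ∀ n m a b → a < 2 ^ n → b < 2 ^ m → a * b < 2 ^ (n + m)
  product-bound n m a b a< b< = subst (a * b <_) (sym (2^-+ n m)) (*-mono-< a< b<)

  -- Extra fuel does not change s₂-aux once it covers the bit length, so s₂ can be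
  -- computed with any sufficient fuel; this yields the two recursion equations of s₂.
  s₂-aux-0 : ∀ k → s₂-aux k 0 ≡ 0
  s₂-aux-0 zero = refl
  s₂-aux-0 (suc k) = s₂-aux-0 k

  s₂-aux-stable : ∀ k k' n → n < 2 ^ k → k ≤ k' → s₂-aux k' n ≡ s₂-aux k n
  s₂-aux-stable zero k' zero _ _ = s₂-aux-0 k'
  s₂-aux-stable zero k' (suc n) (s≤s ()) _
  s₂-aux-stable (suc k) (suc k') n n< (s≤s k≤k') =
    cong (n % 2 +_) (s₂-aux-stable k k' (n / 2) (m<n*o⇒m/o<n (subst (n <_) (*-comm 2 (2 ^ k)) n<)) k≤k')

  s₂-fuel : ∀ k n → n < 2 ^ k → s₂ n ≡ s₂-aux k n
  s₂-fuel k n n< = trans (sym (s₂-aux-stable n (n ⊔ k) n (n<2^n n) (m≤m⊔n n k)))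
                         (s₂-aux-stable k (n ⊔ k) n n< (m≤n⊔m n k))

  halve-bound : ∀ b h → b < 2 → b + h * 2 < 2 ^ suc h
  halve-bound b h b<2 = begin-strict
      b + h * 2 <⟨ +-monoˡ-< (h * 2) b<2 ⟩
      suc h * 2 ≤⟨ *-monoˡ-≤ 2 (n<2^n h) ⟩
      2 ^ h * 2 ≡⟨ *-comm (2 ^ h) 2 ⟩
      2 ^ suc h ∎
    where open ≤-Reasoning

  s₂-even : ∀ h → s₂ (h * 2) ≡ s₂ h
  s₂-even h = begin
      s₂ (h * 2)                         ≡⟨ s₂-fuel (suc h) (h * 2) (halve-bound 0 h (s≤s z≤n)) ⟩
      (h * 2) % 2 + s₂-aux h (h * 2 / 2) ≡⟨ cong₂ _+_ (m*n%n≡0 h 2) (cong (s₂-aux h) (m*n/n≡m h 2)) ⟩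
      s₂ h                               ∎
    where open ≡-Reasoning

  s₂-odd : ∀ h → s₂ (1 + h * 2) ≡ 1 + s₂ h
  s₂-odd h = begin
      s₂ (1 + h * 2)                               ≡⟨ s₂-fuel (suc h) (1 + h * 2) (halve-bound 1 h (s≤s (s≤s z≤n))) ⟩
      (1 + h * 2) % 2 + s₂-aux h ((1 + h * 2) / 2) ≡⟨ cong₂ _+_ ([m+kn]%n≡m%n 1 h 2) (cong (s₂-aux h) half) ⟩
      1 + s₂ h                                     ∎
    where
      open ≡-Reasoning
      half : (1 + h * 2) / 2 ≡ h
      half = trans (+-distrib-/-∣ʳ 1 {h * 2} {2} (n∣m*n h)) (m*n/n≡m h 2)

  halve-bound⁻¹ : ∀ b h n → b + h * 2 < 2 ^ suc n → h < 2 ^ n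
  halve-bound⁻¹ b h n lt =
    *-cancelʳ-< 2 h (2 ^ n) (≤-<-trans (m≤n+m (h * 2) b) (subst (b + h * 2 <_) (*-comm 2 (2 ^ n)) lt))

  s₂-concat : ∀ n a b → a < 2 ^ n → s₂ (a + 2 ^ n * b) ≡ s₂ a + s₂ b
  s₂-concat zero zero b _ = cong s₂ (+-identityʳ b)
  s₂-concat zero (suc a) b (s≤s ())
  s₂-concat (suc n) a b a< with halve a
  ... | inj₁ (h , refl) = begin
      s₂ (h * 2 + 2 ^ suc n * b) ≡⟨ cong s₂ (shift h (2 ^ n) b) ⟩
      s₂ ((h + 2 ^ n * b) * 2)   ≡⟨ s₂-even (h + 2 ^ n * b) ⟩
      s₂ (h + 2 ^ n * b)         ≡⟨ s₂-concat n h b (halve-bound⁻¹ 0 h n a<) ⟩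
      s₂ h + s₂ b                ≡⟨ cong (_+ s₂ b) (sym (s₂-even h)) ⟩
      s₂ (h * 2) + s₂ b          ∎
    where
      open ≡-Reasoning
      shift : ∀ h P b → h * 2 + (2 * P) * b ≡ (h + P * b) * 2
      shift = solve-∀
  ... | inj₂ (h , refl) = begin
      s₂ ((1 + h * 2) + 2 ^ suc n * b) ≡⟨ cong s₂ (shift h (2 ^ n) b) ⟩
      s₂ (1 + (h + 2 ^ n * b) * 2)     ≡⟨ s₂-odd (h + 2 ^ n * b) ⟩
      1 + s₂ (h + 2 ^ n * b)           ≡⟨ cong suc (s₂-concat n h b (halve-bound⁻¹ 1 h n a<)) ⟩
      1 + (s₂ h + s₂ b)                ≡⟨ cong (_+ s₂ b) (sym (s₂-odd h)) ⟩
      s₂ (1 + h * 2) + s₂ b            ∎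
    where
      open ≡-Reasoning
      shift : ∀ h P b → (1 + h * 2) + (2 * P) * b ≡ 1 + (h + P * b) * 2
      shift = solve-∀

  s₂-shift : ∀ n b → s₂ (2 ^ n * b) ≡ s₂ b
  s₂-shift n b = s₂-concat n 0 b (m^n>0 2 n)

  s₂-bit : ∀ b → b < 2 → s₂ b ≡ b
  s₂-bit zero _ = refl
  s₂-bit (suc zero) _ = refl
  s₂-bit (suc (suc b)) (s≤s (s≤s ()))

  -- Complement: if a + b = 2^n − 1, adding a and b produces no carries, so each of
  -- the n positions carries a one in exactly one of them.
  s₂-complement : ∀ n a b → a + b + 1 ≡ 2 ^ n → s₂ a + s₂ b ≡ n
  s₂-complement zero zero zero _ = refl
  s₂-complement zero zero (suc b) eq with () ← m+n≡0⇒n≡0 b (suc-injective eq)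
  s₂-complement zero (suc a) b eq with () ← m+n≡0⇒n≡0 (a + b) (suc-injective eq)
  s₂-complement (suc n) a b eq with halve a | halve b
  ... | inj₁ (h , refl) | inj₁ (g , refl) =
    ⊥-elim (even≢odd (2 ^ n) (h + g) (trans (sym eq) (double-odd h g)))
    where
      double-odd : ∀ h g → h * 2 + g * 2 + 1 ≡ suc (2 * (h + g))
      double-odd = solve-∀
  ... | inj₁ (h , refl) | inj₂ (g , refl) = begin
      s₂ (h * 2) + s₂ (1 + g * 2) ≡⟨ cong₂ _+_ (s₂-even h) (s₂-odd g) ⟩
      s₂ h + (1 + s₂ g)           ≡⟨ +-suc (s₂ h) (s₂ g) ⟩
      suc (s₂ h + s₂ g)           ≡⟨ cong suc (s₂-complement n h g halved) ⟩
      suc n                       ∎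
    where
      open ≡-Reasoning
      carry : ∀ h g → 2 * (h + g + 1) ≡ h * 2 + (1 + g * 2) + 1
      carry = solve-∀
      halved : h + g + 1 ≡ 2 ^ n
      halved = *-cancelˡ-≡ (h + g + 1) (2 ^ n) 2 (trans (carry h g) eq)
  ... | inj₂ (h , refl) | inj₁ (g , refl) = begin
      s₂ (1 + h * 2) + s₂ (g * 2) ≡⟨ cong₂ _+_ (s₂-odd h) (s₂-even g) ⟩
      suc (s₂ h + s₂ g)           ≡⟨ cong suc (s₂-complement n h g halved) ⟩
      suc n                       ∎
    where
      open ≡-Reasoning
      carry : ∀ h g → 2 * (h + g + 1) ≡ (1 + h * 2) + g * 2 + 1
      carry = solve-∀
      halved : h + g + 1 ≡ 2 ^ n
      halved = *-cancelˡ-≡ (h + g + 1) (2 ^ n) 2 (trans (carry h g) eq)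
  ... | inj₂ (h , refl) | inj₂ (g , refl) =
    ⊥-elim (even≢odd (2 ^ n) (h + g + 1) (trans (sym eq) (double-odd h g)))
    where
      double-odd : ∀ h g → (1 + h * 2) + (1 + g * 2) + 1 ≡ suc (2 * (h + g + 1))
      double-odd = solve-∀

  s₂-all-ones : ∀ n → s₂ (2 ^ n ∸ 1) ≡ n
  s₂-all-ones n = trans (sym (+-identityʳ _))
    (s₂-complement n (2 ^ n ∸ 1) 0 (trans (cong (_+ 1) (+-identityʳ _)) (m∸n+n≡m (m^n>0 2 n))))

  tri : ℕ → ℕ
  tri zero = 0
  tri (suc m) = suc m + tri m

  2*tri : ∀ m → 2 * tri m ≡ m * suc m
  2*tri zero = refl
  2*tri (suc m) = begin
      2 * (suc m + tri m)       ≡⟨ *-distribˡ-+ 2 (suc m) (tri m) ⟩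
      2 * suc m + 2 * tri m     ≡⟨ cong (2 * suc m +_) (2*tri m) ⟩
      2 * suc m + m * suc m     ≡⟨ *-distribʳ-+ (suc m) 2 m ⟨
      suc (suc m) * suc m       ≡⟨ *-comm (suc (suc m)) (suc m) ⟩
      suc m * suc (suc m)       ∎
    where open ≡-Reasoning

  -- Repetition of a fixed number u.  rep m consists of m copies of u, consecutive copies
  -- separated by so many zeros that in rep m · rep m the squares u·u of the copies and the
  -- cross terms 2·u·u never overlap.
  module Repetition (u : ℕ) where

    width : ℕ → ℕ
    width zero = 0
    width (suc m) = (width m + u + u + 2) + width m

    gap : ℕ → ℕ
    gap m = width m + u + u + 2

    rep : ℕ → ℕ
    rep zero = 0
    rep (suc m) = u + 2 ^ gap m * rep m

    u+u≤gap : ∀ m → u + u ≤ gap m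
    u+u≤gap m = begin
        u + u               ≤⟨ m≤n+m (u + u) (width m) ⟩
        width m + (u + u)   ≡⟨ +-assoc (width m) u u ⟨
        width m + u + u     ≤⟨ m≤m+n (width m + u + u) 2 ⟩
        gap m               ∎
      where open ≤-Reasoning

    u<2^gap : ∀ m → u < 2 ^ gap m
    u<2^gap m = <2^-mono (n<2^n u) (≤-trans (m≤m+n u u) (u+u≤gap m))

    u*u<2^gap : ∀ m → u * u < 2 ^ gap m
    u*u<2^gap m = <2^-mono (product-bound u u u u (n<2^n u) (n<2^n u)) (u+u≤gap m)

    rep<2^width : ∀ m → rep m < 2 ^ width m
    rep<2^width zero = s≤s z≤n
    rep<2^width (suc m) = concat-bound (gap m) (width m) u (rep m) (u<2^gap m) (rep<2^width m)

    s₂-rep : ∀ m → s₂ (rep m) ≡ m * s₂ u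
    s₂-rep zero = refl
    s₂-rep (suc m) = trans (s₂-concat (gap m) u (rep m) (u<2^gap m)) (cong (s₂ u +_) (s₂-rep m))

    -- The cross terms: u · rep m consists of m copies of u·u.
    s₂-u*rep : ∀ m → s₂ (u * rep m) ≡ m * s₂ (u * u)
    s₂-u*rep zero = cong s₂ (*-zeroʳ u)
    s₂-u*rep (suc m) = begin
        s₂ (u * (u + 2 ^ gap m * rep m))     ≡⟨ cong s₂ (expand u (2 ^ gap m) (rep m)) ⟩
        s₂ (u * u + 2 ^ gap m * (u * rep m)) ≡⟨ s₂-concat (gap m) (u * u) (u * rep m) (u*u<2^gap m) ⟩
        s₂ (u * u) + s₂ (u * rep m)          ≡⟨ cong (s₂ (u * u) +_) (s₂-u*rep m) ⟩
        suc m * s₂ (u * u)                   ∎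
      where
        open ≡-Reasoning
        expand : ∀ u X V → u * (u + X * V) ≡ u * u + X * (u * V)
        expand = solve-∀

    -- (u + X·V)² = (u² + 2X·uV) + X²·V² with the two summands occupying disjoint bits.
    s₂-rep² : ∀ m → s₂ (rep m * rep m) ≡ tri m * s₂ (u * u)
    s₂-rep² zero = refl
    s₂-rep² (suc m) = begin
        s₂ (rep (suc m) * rep (suc m))                     ≡⟨ cong s₂ (square u X (rep m)) ⟩
        s₂ (low + (X * X) * (rep m * rep m))               ≡⟨ cong (λ z → s₂ (low + z * (rep m * rep m))) (sym (2^-+ N N)) ⟩
        s₂ (low + 2 ^ (N + N) * (rep m * rep m))           ≡⟨ s₂-concat (N + N) low (rep m * rep m) low< ⟩
        s₂ low + s₂ (rep m * rep m)                        ≡⟨ cong₂ _+_ s₂-low (s₂-rep² m) ⟩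
        (s₂ (u * u) + m * s₂ (u * u)) + tri m * s₂ (u * u) ≡⟨ collect (s₂ (u * u)) m (tri m) ⟩
        tri (suc m) * s₂ (u * u)                           ∎
      where
        open ≡-Reasoning
        N = gap m
        X = 2 ^ N
        low = u * u + (2 * X) * (u * rep m)
        square : ∀ u X V → (u + X * V) * (u + X * V) ≡ (u * u + (2 * X) * (u * V)) + (X * X) * (V * V)
        square = solve-∀
        collect : ∀ y m t → (y + m * y) + t * y ≡ (1 + m + t) * y
        collect = solve-∀
        u*u<2^1+gap : u * u < 2 ^ suc N
        u*u<2^1+gap = <2^-mono (u*u<2^gap m) (n≤1+n N)
        s₂-low : s₂ low ≡ s₂ (u * u) + m * s₂ (u * u)
        s₂-low = trans (s₂-concat (suc N) (u * u) (u * rep m) u*u<2^1+gap) (cong (s₂ (u * u) +_) (s₂-u*rep m))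
        regroup : ∀ w u → w + u + u + 2 ≡ suc (u + w) + (u + 1)
        regroup = solve-∀
        fits : suc N + (u + width m) ≤ N + N
        fits = subst (_≤ N + N) (+-suc N (u + width m))
          (+-monoʳ-≤ N (subst (suc (u + width m) ≤_) (sym (regroup (width m) u)) (m≤m+n _ (u + 1))))
        low< : low < 2 ^ (N + N)
        low< = <2^-mono (concat-bound (suc N) (u + width m) (u * u) (u * rep m) u*u<2^1+gap
                          (product-bound u (width m) u (rep m) (n<2^n u) (rep<2^width m))) fits

  bit<2^suc : ∀ {b} n → b < 2 → b < 2 ^ suc n
  bit<2^suc n b<2 = <2^-mono {n = 1} {n' = suc n} b<2 (s≤s z≤n)

  suc<2^suc : ∀ {a} n → a < 2 ^ n → suc a < 2 ^ suc n
  suc<2^suc n a< = ≤-<-trans a< (^-monoʳ-< 2 (s≤s (s≤s z≤n)) {n} {suc n} (n<1+n n))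

  -- The square of u = P − w, written without subtraction: if w = Y + v, P = u + w,
  -- G = 2P, X = G·(E1 + 1), P² = G·Y·(F1 + 1) and w² + X·Y = X·w + 1 + R, then
  -- u² = P² − G·w + w² = G·Y·F1 + 1 + (G·E1·v + R).
  square-of-difference : ∀ u w Y v E1 F1 R P G X → w ≡ Y + v → u + w ≡ P → G ≡ 2 * P →
    X ≡ G * (E1 + 1) → P * P ≡ G * Y * (F1 + 1) → w * w + X * Y ≡ X * w + 1 + R →
    u * u ≡ G * Y * F1 + (1 + (G * E1 * v + R))
  square-of-difference u _ Y v E1 F1 R _ _ _ refl refl refl refl P² w² =
    +-cancelʳ-≡ (X * w + G * Y) (u * u) (G * Y * F1 + (1 + (G * E1 * v + R))) (begin
      u * u + (X * w + G * Y)                          ≡⟨ expand u Y v E1 ⟩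
      P * P + G * E1 * v + (w * w + X * Y)             ≡⟨ cong₂ (λ a b → a + G * E1 * v + b) P² w² ⟩
      G * Y * (F1 + 1) + G * E1 * v + (X * w + 1 + R) ≡⟨ regroup G Y F1 E1 v X w R ⟩
      (G * Y * F1 + (1 + (G * E1 * v + R))) + (X * w + G * Y) ∎)
    where
      open ≡-Reasoning
      w = Y + v
      P = u + w
      G = 2 * P
      X = G * (E1 + 1)
      expand : ∀ u Y v E1 → let w = Y + v ; P = u + w ; G = 2 * P ; X = G * (E1 + 1) in
        u * u + (X * w + G * Y) ≡ P * P + G * E1 * v + (w * w + X * Y)
      expand = solve-∀
      regroup : ∀ G Y F1 E1 v X w R → G * Y * (F1 + 1) + G * E1 * v + (X * w + 1 + R)
        ≡ (G * Y * F1 + (1 + (G * E1 * v + R))) + (X * w + G * Y)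
      regroup = solve-∀

  -- A family of numbers whose squares have few ones.  Then u t has D t + f + 1 − t ones, while
  --   u t ² = 2^(2 D t + f + 2)·(2^f − 1) + 1 + S t,   S t = G·(2^e − 1)·v + R,
  -- where S t splits into carry-free blocks with t·e + T t ones in total.
  module Family (e f : ℕ) where

    c : ℕ
    c = e + 2 + f

    D : ℕ → ℕ
    D zero = 0
    D (suc t) = D t + (D t + c)

    D+c : ∀ t → D t + c ≡ c * 2 ^ t
    D+c zero = sym (*-identityʳ c)
    D+c (suc t) = begin
        D t + (D t + c) + c     ≡⟨ regroup (D t) c ⟩
        (D t + c) + (D t + c)   ≡⟨ cong (λ z → z + z) (D+c t) ⟩
        c * 2 ^ t + c * 2 ^ t   ≡⟨ double c (2 ^ t) ⟩
        c * 2 ^ suc t           ∎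
      where
        open ≡-Reasoning
        regroup : ∀ d c → d + (d + c) + c ≡ (d + c) + (d + c)
        regroup = solve-∀
        double : ∀ c p → c * p + c * p ≡ c * (2 * p)
        double = solve-∀

    X Y G P : ℕ → ℕ
    X t = 2 ^ (D t + c)
    Y t = 2 ^ D t
    G t = 2 ^ (D t + f + 2)
    P t = 2 ^ (D t + f + 1)

    E1 F1 : ℕ
    E1 = 2 ^ e ∸ 1
    F1 = 2 ^ f ∸ 1

    E1+1 : E1 + 1 ≡ 2 ^ e
    E1+1 = m∸n+n≡m (m^n>0 2 e)

    F1+1 : F1 + 1 ≡ 2 ^ f
    F1+1 = m∸n+n≡m (m^n>0 2 f)

    E1<2^e : E1 < 2 ^ e
    E1<2^e = subst (E1 <_) E1+1 (≤-reflexive (+-comm 1 E1))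

    Y-step : ∀ t → Y (suc t) ≡ Y t * X t
    Y-step t = 2^-+ (D t) (D t + c)

    X-step : ∀ t → X (suc t) ≡ X t * X t
    X-step t = trans (cong (2 ^_) (regroup (D t) c)) (2^-+ (D t + c) (D t + c))
      where
        regroup : ∀ d c → d + (d + c) + c ≡ (d + c) + (d + c)
        regroup = solve-∀

    G-step : ∀ t → G (suc t) ≡ G t * X t
    G-step t = trans (cong (2 ^_) (regroup (D t) c f)) (2^-+ (D t + f + 2) (D t + c))
      where
        regroup : ∀ d c f → d + (d + c) + f + 2 ≡ (d + f + 2) + (d + c)
        regroup = solve-∀

    G≡2P : ∀ t → G t ≡ 2 * P t
    G≡2P t = cong (2 ^_) (regroup (D t) f)
      where
        regroup : ∀ d f → d + f + 2 ≡ 1 + (d + f + 1)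
        regroup = solve-∀

    X≡G*2^e : ∀ t → X t ≡ G t * (E1 + 1)
    X≡G*2^e t = begin
        2 ^ (D t + c)            ≡⟨ cong (2 ^_) (regroup (D t) e f) ⟩
        2 ^ ((D t + f + 2) + e)  ≡⟨ 2^-+ (D t + f + 2) e ⟩
        G t * 2 ^ e              ≡⟨ cong (G t *_) E1+1 ⟨
        G t * (E1 + 1)           ∎
      where
        open ≡-Reasoning
        regroup : ∀ d e f → d + (e + 2 + f) ≡ (d + f + 2) + e
        regroup = solve-∀

    P²≡GY*2^f : ∀ t → P t * P t ≡ G t * Y t * (F1 + 1)
    P²≡GY*2^f t = begin
        P t * P t                           ≡⟨ 2^-+ (D t + f + 1) (D t + f + 1) ⟨
        2 ^ ((D t + f + 1) + (D t + f + 1)) ≡⟨ cong (2 ^_) (regroup (D t) f) ⟩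
        2 ^ (((D t + f + 2) + D t) + f)     ≡⟨ 2^-+ ((D t + f + 2) + D t) f ⟩
        2 ^ ((D t + f + 2) + D t) * 2 ^ f   ≡⟨ cong₂ _*_ (2^-+ (D t + f + 2) (D t)) (sym F1+1) ⟩
        G t * Y t * (F1 + 1)                ∎
      where
        open ≡-Reasoning
        regroup : ∀ d f → (d + f + 1) + (d + f + 1) ≡ ((d + f + 2) + d) + f
        regroup = solve-∀

    1<X : ∀ t → 1 < X t
    1<X t = subst (λ k → 1 < 2 ^ k) (sym (regroup (D t) e f)) (bit<2^suc (D t + (e + 1 + f)) (s≤s (s≤s z≤n)))
      where
        regroup : ∀ d e f → d + (e + 2 + f) ≡ suc (d + (e + 1 + f))
        regroup = solve-∀

    w v : ℕ → ℕ
    w zero = 1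
    w (suc t) = 1 + X t * w t
    v zero = 0
    v (suc t) = 1 + X t * v t

    w≡Y+v : ∀ t → w t ≡ Y t + v t
    w≡Y+v zero = refl
    w≡Y+v (suc t) = begin
        1 + X t * w t         ≡⟨ cong (λ z → 1 + X t * z) (w≡Y+v t) ⟩
        1 + X t * (Y t + v t) ≡⟨ regroup (X t) (Y t) (v t) ⟩
        Y t * X t + v (suc t) ≡⟨ cong (_+ v (suc t)) (Y-step t) ⟨
        Y (suc t) + v (suc t) ∎
      where
        open ≡-Reasoning
        regroup : ∀ X Y v → 1 + X * (Y + v) ≡ Y * X + (1 + X * v)
        regroup = solve-∀

    w<2^[1+D] : ∀ t → w t < 2 ^ suc (D t)
    w<2^[1+D] zero = s≤s (s≤s z≤n)
    w<2^[1+D] (suc t) = begin-strict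
        1 + X t * w t          <⟨ +-monoˡ-< (X t * w t) (1<X t) ⟩
        X t + X t * w t        ≡⟨ cong (_+ X t * w t) (*-identityʳ (X t)) ⟨
        X t * 1 + X t * w t    ≡⟨ *-distribˡ-+ (X t) 1 (w t) ⟨
        X t * suc (w t)        ≤⟨ *-monoʳ-≤ (X t) (w<2^[1+D] t) ⟩
        X t * 2 ^ suc (D t)    ≡⟨ regroup (X t) (Y t) ⟩
        2 * (Y t * X t)        ≡⟨ cong (2 *_) (Y-step t) ⟨
        2 ^ suc (D (suc t))    ∎
      where
        open ≤-Reasoning
        regroup : ∀ X Y → X * (2 * Y) ≡ 2 * (Y * X)
        regroup = solve-∀

    s₂-w : ∀ t → s₂ (w t) ≡ suc t
    s₂-w zero = refl
    s₂-w (suc t) = trans (s₂-concat (D t + c) 1 (w t) (1<X t)) (cong suc (s₂-w t))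

    -- R t collects the carry-free remainder of w t ², as recorded by w²-identity.
    R : ℕ → ℕ
    R zero = 0
    R (suc t) = X t * X t * R t + 2 * X t * w t

    w²-identity : ∀ t → w t * w t + X t * Y t ≡ X t * w t + 1 + R t
    w²-identity zero = base (X 0)
      where
        base : ∀ X → 1 * 1 + X * 1 ≡ X * 1 + 1 + 0
        base = solve-∀
    w²-identity (suc t) = begin
        w (suc t) * w (suc t) + X (suc t) * Y (suc t)                  ≡⟨ cong₂ (λ a b → w (suc t) * w (suc t) + a * b) (X-step t) (Y-step t) ⟩
        (1 + X t * w t) * (1 + X t * w t) + (X t * X t) * (Y t * X t)  ≡⟨ expand (X t) (w t) (Y t) ⟩
        1 + 2 * X t * w t + X t * X t * (w t * w t + X t * Y t)        ≡⟨ cong (λ z → 1 + 2 * X t * w t + X t * X t * z) (w²-identity t) ⟩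
        1 + 2 * X t * w t + X t * X t * (X t * w t + 1 + R t)          ≡⟨ regroup (X t) (w t) (R t) ⟩
        (X t * X t) * w (suc t) + 1 + R (suc t)                        ≡⟨ cong (λ z → z * w (suc t) + 1 + R (suc t)) (X-step t) ⟨
        X (suc t) * w (suc t) + 1 + R (suc t)                          ∎
      where
        open ≡-Reasoning
        expand : ∀ X w Y → (1 + X * w) * (1 + X * w) + (X * X) * (Y * X) ≡ 1 + 2 * X * w + X * X * (w * w + X * Y)
        expand = solve-∀
        regroup : ∀ X w R → 1 + 2 * X * w + X * X * (X * w + 1 + R) ≡ (X * X) * (1 + X * w) + 1 + (X * X * R + 2 * X * w)
        regroup = solve-∀

    u : ℕ → ℕ
    u t = P t ∸ w t

    u+w≡P : ∀ t → u t + w t ≡ P t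
    u+w≡P t = m∸n+n≡m (<⇒≤ (<2^-mono (w<2^[1+D] t) 1+D≤D+f+1))
      where
        1+D≤D+f+1 : suc (D t) ≤ D t + f + 1
        1+D≤D+f+1 = subst (suc (D t) ≤_) (+-comm 1 (D t + f)) (s≤s (m≤m+n (D t) f))

    -- Complementing w t (t + 1 ones) inside D t + f + 1 bits leaves D t + f + 1 − t ones.
    s₂-u : ∀ t → s₂ (u t) + t ≡ D t + f + 1
    s₂-u zero = s₂-complement (D 0 + f + 1) (u 0) 0 (trans (cong (_+ 1) (+-identityʳ (u 0))) (u+w≡P 0))
    s₂-u (suc t) = begin
        s₂ (u (suc t)) + suc t                 ≡⟨ cong (s₂ (u (suc t)) +_) (trans (sym (s₂-w t)) (sym (s₂-shift (D t + c) (w t)))) ⟩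
        s₂ (u (suc t)) + s₂ (X t * w t)        ≡⟨ s₂-complement (D (suc t) + f + 1) (u (suc t)) (X t * w t) complements ⟩
        D (suc t) + f + 1                      ∎
      where
        open ≡-Reasoning
        complements : u (suc t) + X t * w t + 1 ≡ P (suc t)
        complements = trans (+-assoc (u (suc t)) (X t * w t) 1)
                        (trans (cong (u (suc t) +_) (+-comm (X t * w t) 1)) (u+w≡P (suc t)))

    -- The low part S t of u t ², built recursively from blocks B t.
    S B : ℕ → ℕ
    S t = G t * E1 * v t + R t
    B t = 2 * X t * w t + G (suc t) * E1

    S-step : ∀ t → S (suc t) ≡ B t + 2 ^ ((D t + c) + (D t + c)) * S t
    S-step t = begin
        G (suc t) * E1 * (1 + X t * v t) + R (suc t)                           ≡⟨ cong (λ z → z * E1 * (1 + X t * v t) + R (suc t)) (G-step t) ⟩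
        (G t * X t) * E1 * (1 + X t * v t) + (X t * X t * R t + 2 * X t * w t) ≡⟨ regroup (G t) (X t) E1 (v t) (R t) (w t) ⟩
        (2 * X t * w t + (G t * X t) * E1) + X t * X t * S t                  ≡⟨ cong₂ (λ a b → (2 * X t * w t + a * E1) + b * S t) (sym (G-step t)) (sym (2^-+ (D t + c) (D t + c))) ⟩
        B t + 2 ^ ((D t + c) + (D t + c)) * S t                                ∎
      where
        open ≡-Reasoning
        regroup : ∀ G X E1 v R w → (G * X) * E1 * (1 + X * v) + (X * X * R + 2 * X * w)
          ≡ (2 * X * w + (G * X) * E1) + X * X * (G * E1 * v + R)
        regroup = solve-∀

    S0≡0 : S 0 ≡ 0
    S0≡0 = cong (_+ 0) (*-zeroʳ (G 0 * E1))

    low<G : ∀ b t → b < 2 → b + 2 * X t * w t < G (suc t)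
    low<G b t b<2 = <2^-mono (concat-bound (suc (D t + c)) (suc (D t)) b (w t) (bit<2^suc (D t + c) b<2) (w<2^[1+D] t)) fits
      where
        regroup : ∀ d c f → d + (d + c) + f + 2 ≡ ((1 + (d + c)) + (1 + d)) + f
        regroup = solve-∀
        fits : suc (D t + c) + suc (D t) ≤ D (suc t) + f + 2
        fits = subst (suc (D t + c) + suc (D t) ≤_) (sym (regroup (D t) c f)) (m≤m+n _ f)

    B-bound : ∀ b t → b < 2 → b + B t < 2 ^ ((D t + c) + (D t + c))
    B-bound b t b<2 = subst₂ _<_ (+-assoc b (2 * X t * w t) (G (suc t) * E1)) (cong (2 ^_) (regroup (D t) e f))
      (concat-bound (D (suc t) + f + 2) e (b + 2 * X t * w t) E1 (low<G b t b<2) E1<2^e)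
      where
        regroup : ∀ d e f → (d + (d + (e + 2 + f)) + f + 2) + e ≡ (d + (e + 2 + f)) + (d + (e + 2 + f))
        regroup = solve-∀

    S-bound : ∀ t → S t < 2 ^ (D t + D t)
    S-bound zero = subst (_< 1) (sym S0≡0) (s≤s z≤n)
    S-bound (suc t) = subst₂ _<_ (sym (S-step t)) (cong (2 ^_) (regroup (D t) c))
      (concat-bound ((D t + c) + (D t + c)) (D t + D t) (B t) (S t) (B-bound 0 t (s≤s z≤n)) (S-bound t))
      where
        regroup : ∀ d c → (d + c + (d + c)) + (d + d) ≡ (d + (d + c)) + (d + (d + c))
        regroup = solve-∀

    s₂-B : ∀ b t → b < 2 → s₂ (b + B t) ≡ b + suc t + e
    s₂-B b t b<2 = begin
        s₂ (b + B t)                              ≡⟨ cong s₂ (+-assoc b (2 * X t * w t) (G (suc t) * E1)) ⟨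
        s₂ ((b + 2 * X t * w t) + G (suc t) * E1) ≡⟨ s₂-concat (D (suc t) + f + 2) _ E1 (low<G b t b<2) ⟩
        s₂ (b + 2 * X t * w t) + s₂ E1            ≡⟨ cong₂ _+_ (s₂-concat (suc (D t + c)) b (w t) (bit<2^suc (D t + c) b<2)) (s₂-all-ones e) ⟩
        s₂ b + s₂ (w t) + e                       ≡⟨ cong (_+ e) (cong₂ _+_ (s₂-bit b b<2) (s₂-w t)) ⟩
        b + suc t + e                             ∎
      where open ≡-Reasoning

    s₂-S : ∀ b t → b < 2 → s₂ (b + S t) ≡ b + (t * e + tri t)
    s₂-S b zero b<2 = begin
        s₂ (b + S 0) ≡⟨ cong (λ z → s₂ (b + z)) S0≡0 ⟩
        s₂ (b + 0)   ≡⟨ cong s₂ (+-identityʳ b) ⟩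
        s₂ b         ≡⟨ s₂-bit b b<2 ⟩
        b            ≡⟨ +-identityʳ b ⟨
        b + 0        ∎
      where open ≡-Reasoning
    s₂-S b (suc t) b<2 = begin
        s₂ (b + S (suc t))                  ≡⟨ cong (λ z → s₂ (b + z)) (S-step t) ⟩
        s₂ (b + (B t + 2 ^ K * S t))        ≡⟨ cong s₂ (+-assoc b (B t) (2 ^ K * S t)) ⟨
        s₂ ((b + B t) + 2 ^ K * S t)        ≡⟨ s₂-concat K (b + B t) (S t) (B-bound b t b<2) ⟩
        s₂ (b + B t) + s₂ (S t)             ≡⟨ cong₂ _+_ (s₂-B b t b<2) (s₂-S 0 t (s≤s z≤n)) ⟩
        (b + suc t + e) + (t * e + tri t)   ≡⟨ regroup b t e (tri t) ⟩
        b + (suc t * e + tri (suc t))       ∎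
      where
        open ≡-Reasoning
        K = (D t + c) + (D t + c)
        regroup : ∀ b t e T → (b + (1 + t) + e) + (t * e + T) ≡ b + ((1 + t) * e + ((1 + t) + T))
        regroup = solve-∀

    u² : ∀ t → u t * u t ≡ G t * Y t * F1 + (1 + S t)
    u² t = square-of-difference (u t) (w t) (Y t) (v t) E1 F1 (R t) (P t) (G t) (X t)
             (w≡Y+v t) (u+w≡P t) (G≡2P t) (X≡G*2^e t) (P²≡GY*2^f t) (w²-identity t)

    s₂-u² : ∀ t → s₂ (u t * u t) ≡ (1 + (t * e + tri t)) + f
    s₂-u² t = begin
        s₂ (u t * u t)                                  ≡⟨ cong s₂ (trans (u² t) (+-comm (G t * Y t * F1) (1 + S t))) ⟩
        s₂ ((1 + S t) + G t * Y t * F1)                 ≡⟨ cong (λ z → s₂ ((1 + S t) + z * F1)) (2^-+ (D t + f + 2) (D t)) ⟨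
        s₂ ((1 + S t) + 2 ^ ((D t + f + 2) + D t) * F1) ≡⟨ s₂-concat ((D t + f + 2) + D t) (1 + S t) F1 1+S< ⟩
        s₂ (1 + S t) + s₂ F1                            ≡⟨ cong₂ _+_ (s₂-S 1 t (s≤s (s≤s z≤n))) (s₂-all-ones f) ⟩
        (1 + (t * e + tri t)) + f                       ∎
      where
        open ≡-Reasoning
        regroup : ∀ d f → (d + f + 2) + d ≡ (1 + (d + d)) + (1 + f)
        regroup = solve-∀
        1+S< : 1 + S t < 2 ^ ((D t + f + 2) + D t)
        1+S< = <2^-mono (suc<2^suc (D t + D t) (S-bound t))
                 (subst (suc (D t + D t) ≤_) (sym (regroup (D t) f)) (m≤m+n _ (1 + f)))

  Reciprocal : ℕ → Set
  Reciprocal Q = Σ ℕ λ u → NonZero (s₂ (u * u)) × s₂ u ≡ Q * s₂ (u * u)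

  Realises : ℕ → ℕ → Set
  Realises p q = Σ ℕ λ U → NonZero (s₂ U) × s₂ (U * U) * q ≡ p * s₂ U

  -- If 2^(1 + (h+1)(ρ+1)) = Q + ρ + 1 with Q ≥ 1, the family member with
  -- t = 1 + (h+1)(ρ+1) satisfies s₂ u = Q·s₂(u²) for suitable e, f: since D t + c = c·2^t,
  -- the condition D t + f + 1 − t = Q·(1 + t·e + T t + f) is linear in e and f, and the
  -- choice below solves it in natural numbers thanks to the factor ρ + 1 of t − 1.
  reciprocal : ∀ Q1 ρ h → 2 ^ suc (suc h * suc ρ) ≡ suc Q1 + suc ρ → Reciprocal (suc Q1)
  reciprocal Q1 ρ h 2^t≡Q+ρ+1 = F.u t , y≢0 , x≡Qy
    where
      s = suc h * suc ρ
      t = suc s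
      Q = suc Q1
      T = s + tri s
      e = ρ * (2 + s + Q * T)
      f = s + Q * T + e * (Q1 * suc h + h)
      module F = Family e f
      x = s₂ (F.u t)
      y = s₂ (F.u t * F.u t)

      y≢0 : NonZero y
      y≢0 = subst NonZero (sym (F.s₂-u² t)) _

      balance : ∀ ρ h Q1 T →
        let s = suc h * suc ρ
            Q = suc Q1
            e = ρ * (2 + s + Q * T)
            f = s + Q * T + e * (Q1 * suc h + h)
            c = e + 2 + f
        in c * (Q + suc ρ) + f + 1 ≡ c + suc s + Q * ((1 + (suc s * e + suc T)) + f)
      balance = solve-∀
      regroup : ∀ d f c → d + f + 1 + c ≡ (d + c) + f + 1
      regroup = solve-∀

      x≡Qy : x ≡ Q * y
      x≡Qy = +-cancelʳ-≡ (t + F.c) x (Q * y) (begin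
          x + (t + F.c)                             ≡⟨ +-assoc x t F.c ⟨
          x + t + F.c                               ≡⟨ cong (_+ F.c) (F.s₂-u t) ⟩
          F.D t + f + 1 + F.c                       ≡⟨ regroup (F.D t) f F.c ⟩
          (F.D t + F.c) + f + 1                     ≡⟨ cong (λ z → z + f + 1) (trans (F.D+c t) (cong (F.c *_) 2^t≡Q+ρ+1)) ⟩
          F.c * (Q + suc ρ) + f + 1                 ≡⟨ balance ρ h Q1 T ⟩
          F.c + t + Q * ((1 + (t * e + tri t)) + f) ≡⟨ cong (λ z → F.c + t + Q * z) (F.s₂-u² t) ⟨
          F.c + t + Q * y                           ≡⟨ +-comm (F.c + t) (Q * y) ⟩
          Q * y + (F.c + t)                         ≡⟨ cong (Q * y +_) (+-comm F.c t) ⟩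
          Q * y + (t + F.c)                         ∎)
        where open ≡-Reasoning

  -- Scaling.  Repeating a number u with s₂ u = Q·s₂(u²) an odd number m = 2k − 1 of times
  -- multiplies s₂ by m and s₂(·²) by T m = m·k, so the ratio becomes k/Q.
  scale : ∀ k1 Q1 → Reciprocal (suc Q1) → Realises (suc k1) (suc Q1)
  scale k1 Q1 (u , y≢0 , x≡Qy) = R.rep m , s₂U≢0 , ratio
    where
      module R = Repetition u
      m = suc (2 * k1)
      y = s₂ (u * u)
      U = R.rep m

      s₂U : s₂ U ≡ m * (suc Q1 * y)
      s₂U = trans (R.s₂-rep m) (cong (m *_) x≡Qy)

      s₂U≢0 : NonZero (s₂ U)
      s₂U≢0 = subst NonZero (sym s₂U) (m*n≢0 m (suc Q1 * y) {{_}} {{m*n≢0 (suc Q1) y {{_}} {{y≢0}}}})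

      reassoc : ∀ a b c → 2 * (a * b * c) ≡ 2 * a * b * c
      reassoc = solve-∀
      regroup : ∀ k1 Q1 y → (1 + 2 * k1) * (2 + 2 * k1) * y * (1 + Q1) ≡ 2 * ((1 + k1) * ((1 + 2 * k1) * ((1 + Q1) * y)))
      regroup = solve-∀
      ratio : s₂ (U * U) * suc Q1 ≡ suc k1 * s₂ U
      ratio = *-cancelˡ-≡ _ _ 2 (begin
          2 * (s₂ (U * U) * suc Q1)           ≡⟨ cong (λ z → 2 * (z * suc Q1)) (R.s₂-rep² m) ⟩
          2 * (tri m * y * suc Q1)            ≡⟨ reassoc (tri m) y (suc Q1) ⟩
          2 * tri m * y * suc Q1              ≡⟨ cong (λ z → z * y * suc Q1) (2*tri m) ⟩
          m * suc m * y * suc Q1              ≡⟨ regroup k1 Q1 y ⟩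
          2 * (suc k1 * (m * (suc Q1 * y)))   ≡⟨ cong (λ z → 2 * (suc k1 * z)) s₂U ⟨
          2 * (suc k1 * s₂ U)                 ∎)
        where open ≡-Reasoning

  divide : ∀ N d → suc d ≤ N → Σ ℕ λ j → Σ ℕ λ ρ → ρ < suc d × N ≡ ρ + suc j * suc d
  divide N d d<N with N / suc d | m≥n⇒m/n>0 {N} {suc d} d<N | m≡m%n+[m/n]*n N (suc d)
  ... | suc j | _ | N≡ρ+qd = j , N % suc d , m%n<n N (suc d) , N≡ρ+qd

  ∣factorial : ∀ {ρ} d → ρ < suc d → suc ρ ∣ suc d !
  ∣factorial {ρ} d ρ<1+d = ∣-trans (m∣m*n (ρ !)) (m≤n⇒m!∣n! ρ<1+d)

  cofactor : ∀ {ρ} d → ρ < suc d → Σ ℕ λ h → suc d ! ≡ suc h * suc ρ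
  cofactor d ρ<1+d with ∣factorial d ρ<1+d
  ... | divides zero t₀≡0 with () ← subst (1 ≤_) t₀≡0 (1≤n! (suc d))
  ... | divides (suc h) t₀≡[h+1][ρ+1] = h , t₀≡[h+1][ρ+1]

  1+d<2^[1+t₀] : ∀ d → suc d < 2 ^ suc (suc d !)
  1+d<2^[1+t₀] d = <2^-mono (≤-<-trans (∣⇒≤ {{suc d !≢0}} (∣factorial d ≤-refl)) (n<2^n (suc d !))) (n≤1+n (suc d !))

  -- Denominators.  For t₀ = (d+1)!, write 2^(t₀+1) − 1 = ρ + (j+1)(d+1) with ρ ≤ d; then
  -- ρ + 1 divides t₀, which is the hypothesis of `reciprocal` with Q = (j+1)(d+1).
  denominator : ∀ d → Σ ℕ λ j → Σ ℕ λ ρ → Σ ℕ λ h → 2 ^ suc (suc h * suc ρ) ≡ suc j * suc d + suc ρ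
  denominator d with divide (pred (2 ^ suc (suc d !))) d (<⇒≤pred (1+d<2^[1+t₀] d))
  ... | j , ρ , ρ<1+d , N≡ρ+qd with cofactor d ρ<1+d
  ...   | h , t₀≡[h+1][ρ+1] = j , ρ , h , (begin
      2 ^ suc (suc h * suc ρ)       ≡⟨ cong (λ k → 2 ^ suc k) t₀≡[h+1][ρ+1] ⟨
      2 ^ suc t₀                    ≡⟨ suc-pred (2 ^ suc t₀) {{m^n≢0 2 (suc t₀)}} ⟨
      suc (pred (2 ^ suc t₀))       ≡⟨ cong suc N≡ρ+qd ⟩
      suc (ρ + suc j * suc d)       ≡⟨ cong suc (+-comm ρ (suc j * suc d)) ⟩
      suc (suc j * suc d + ρ)       ≡⟨ +-suc (suc j * suc d) ρ ⟨
      suc j * suc d + suc ρ         ∎)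
    where
      open ≡-Reasoning
      t₀ = suc d !

  cancel : ∀ n d j → Realises (suc n * suc j) (suc j * suc d) → Realises (suc n) (suc d)
  cancel n d j (U , s₂U≢0 , ratio) = U , s₂U≢0 , *-cancelˡ-≡ (a * suc d) (suc n * b) (suc j) (begin
      suc j * (a * suc d)   ≡⟨ regroupˡ a j d ⟩
      a * (suc j * suc d)   ≡⟨ ratio ⟩
      (suc n * suc j) * b   ≡⟨ regroupʳ b j n ⟩
      suc j * (suc n * b)   ∎)
    where
      open ≡-Reasoning
      a = s₂ (U * U)
      b = s₂ U
      regroupˡ : ∀ a j d → (1 + j) * (a * (1 + d)) ≡ a * ((1 + j) * (1 + d))
      regroupˡ = solve-∀
      regroupʳ : ∀ b j n → ((1 + n) * (1 + j)) * b ≡ (1 + j) * ((1 + n) * b)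
      regroupʳ = solve-∀

  fraction : ∀ n d → Realises (suc n) (suc d)
  fraction n d with denominator d
  ... | j , ρ , h , power =
    cancel n d j (scale (j + n * suc j) (d + j * suc d) (reciprocal (d + j * suc d) ρ h power))

open import Data.Nat using (ℕ; suc; _*_; NonZero)
open import Data.Integer using (+_; +[1+_]; +0; -[1+_]; +<+)
open import Data.Integer.Properties using (pos-*)
open import Data.Rational using (ℚ; mkℚ; _/_; _<_; 0ℚ; *<*)
open import Data.Rational.Properties using (fromℚᵘ-cong; ↥p/↧p≡p)
open import Data.Rational.Unnormalised using (mkℚᵘ; *≡*)
open import Data.Product using (Σ; _,_)
open import Relation.Binary.PropositionalEquality using (_≡_; refl; sym; trans; cong)

cross-multiplication : ∀ a b p q → .{{_ : NonZero b}} → a * suc q ≡ p * b → (+ a) / b ≡ (+ p) / suc q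
cross-multiplication a (suc b) p q cross = fromℚᵘ-cong {mkℚᵘ (+ a) b} {mkℚᵘ (+ p) q}
  (*≡* (trans (sym (pos-* a (suc q))) (trans (cong +_ cross) (pos-* p (suc b)))))

positive-fraction : ∀ r → 0ℚ < r → Σ ℕ λ n → Σ ℕ λ d → r ≡ (+ suc n) / suc d
positive-fraction r@(mkℚ +[1+ n ] d _) _ = n , d , sym (↥p/↧p≡p r)
positive-fraction (mkℚ +0 _ _) (*<* (+<+ ()))
positive-fraction (mkℚ -[1+ _ ] _ _) (*<* ())

realised-as-ℚ : ∀ n d → Construction.Realises (suc n) (suc d) →
  Σ ℕ λ u → Σ (NonZero (s₂ u)) λ nz → _/_ (+ s₂ (u * u)) (s₂ u) {{nz}} ≡ (+ suc n) / suc d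
realised-as-ℚ n d (U , s₂U≢0 , cross) =
  U , s₂U≢0 , cross-multiplication (s₂ (U * U)) (s₂ U) (suc n) d {{s₂U≢0}} cross

theorem2p4 : (r : ℚ) → 0ℚ < r →
    Σ ℕ λ u → Σ (NonZero (s₂ u)) λ nz → _/_ (+ s₂ (u * u)) (s₂ u) {{nz}} ≡ r
theorem2p4 r 0<r with positive-fraction r 0<r
... | n , d , refl = realised-as-ℚ n d (Construction.fraction n d)
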